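{- Fix an offline algorithm Off whose permutation $\pi^*$ does not change during the operation considered. Whenever DLM executes fetch$(z)$ for an element $z$, $$\Delta\mathrm{DLM}+\Delta\Psi+\sum_{w\ne z}\Delta\Phi_w\le 2\,\pi(z).$$ Here $\pi(z)$ is the position of $z$ immediately before the fetch, $\Delta\mathrm{DLM}$ is the cost DLM pays for this fetch, and $\Delta$ of a potential is its change caused by the fetch.
   Context: Online Min-Sum Set Cover with requests of cardinality at most $r$, over a universe $\mathcal U$ of $n$ elements. Lists are permutations $\mathcal U\to\{1,\dots,n\}$. Reordering costs one unit per swap of adjacent elements. Algorithm DLM. Every element $z$ has a budget $b(z)$, initially $0$. The operation fetch$(z)$ moves $z$ to position 1 by $\pi(z)-1$ adjacent swaps (cost $\pi(z)-1$), so every element that preceded $z$ moves back by one position, and then sets $b(z)\gets0$. On a request $R$ with $|R|=s$, let $x\in R$ be the element of $R$ with the smallest current position and let $\ell=\pi(x)$. DLM pays $\ell$ and executes fetch$(x)$. For every $y\in R\setminus\{x\}$ it sets $b(y)\gets b(y)+\ell/s$. Then, while some $z$ has $b(z)\ge\pi(z)$, it executes fetch$(z)$. Potentials. Let $\pi$ be DLM's current permutation and $\pi^*$ the current permutation of Off. Write $\pi(z)=2^{p(z)}+q(z)$ with $p(z)\ge0$ an integer and $0\le q(z)\le 2^{p(z)}-1$, and analogously $\pi^*(z)=2^{p^*(z)}+q^*(z)$. Set $\alpha=2$, $\gamma=5r$, $\beta=7.5r+5$ and $\kappa=\lceil\log_2(6\beta)\rceil$. Define - $\Phi_z=\alpha\,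 b(z)$ if $p(z)\le p^*(z)+\kappa$, and $\Phi_z=\beta\,\pi(z)-\gamma\, b(z)$ if $p(z)\ge p^*(z)+\kappa+1$; - $\Psi_z=0$ if $p(z)\le p^*(z)+\kappa-1$, and $\Psi_z=2\beta\, q(z)$ if $p(z)\ge p^*(z)+\kappa$. Set $\Phi=\sum_{z\in\mathcal U}\Phi_z$ and $\Psi=\sum_{z\in\mathcal U}\Psi_z$. -}

module Defs where

open import Data.Nat as ℕ using (ℕ; zero; suc; _≤ᵇ_; _<ᵇ_; _∸_; _^_)
open import Data.Nat.Logarithm using (⌊log₂_⌋; ⌈log₂_⌉)
open import Data.Integer using (+_)
open import Data.Rational using (ℚ; _/_; _+_; _-_; _*_; 0ℚ)
open import Data.Fin using (Fin; toℕ; _≟_)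
open import Data.Fin.Permutation using (Permutation′; _⟨$⟩ʳ_)
open import Data.Bool using (if_then_else_)
open import Relation.Nullary using (yes; no; Dec)
open import Relation.Binary.PropositionalEquality using (_≡_)

ℕ→ℚ : ℕ → ℚ
ℕ→ℚ k = + k / 1

sumℚ : ∀ {n} → (Fin n → ℚ) → ℚ
sumℚ {zero}  f = 0ℚ
sumℚ {suc n} f = f Fin.zero + sumℚ (λ i → f (Fin.suc i))

-- 1-based position of element z in list π (π : universe → positions)
pos : ∀ {n} → Permutation′ n → Fin n → ℕ
pos π z = suc (toℕ (π ⟨$⟩ʳ z))

-- position k = 2^(p k) + q k with 0 ≤ q k ≤ 2^(p k) - 1 (for k ≥ 1)
p : ℕ → ℕ
p k = ⌊log₂ k ⌋

q : ℕ → ℕ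
q k = k ∸ 2 ^ p k

-- constants: α = 2, γ = 5r, β = 7.5r+5 = (15r+10)/2, κ = ⌈log₂(6β)⌉ = ⌈log₂(45r+30)⌉
α : ℚ
α = ℕ→ℚ 2

γ : ℕ → ℚ
γ r = ℕ→ℚ (5 ℕ.* r)

β : ℕ → ℚ
β r = + (15 ℕ.* r ℕ.+ 10) / 2

κ : ℕ → ℕ
κ r = ⌈log₂ (45 ℕ.* r ℕ.+ 30) ⌉

Φelt : (r : ℕ) (pz p*z : ℕ) (bz : ℚ) → ℚ
Φelt r pz p*z bz =
  if p pz ≤ᵇ p p*z ℕ.+ κ r then α * bz else β r * ℕ→ℚ pz - γ r * bz

Ψelt : (r : ℕ) (pz p*z : ℕ) → ℚ
Ψelt r pz p*z =
  if p pz ℕ.+ 1 ≤ᵇ p p*z ℕ.+ κ r then 0ℚ else ℕ→ℚ 2 * β r * ℕ→ℚ (q pz)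

posAfterFetch : ∀ {n} → Permutation′ n → Fin n → Fin n → ℕ
posAfterFetch π z w with w ≟ z
... | yes _ = 1
... | no  _ = if pos π w <ᵇ pos π z then suc (pos π w) else pos π w

budgetAfterFetch : ∀ {n} → (Fin n → ℚ) → Fin n → Fin n → ℚ
budgetAfterFetch b z w with w ≟ z
... | yes _ = 0ℚ
... | no  _ = b w

ΔΨ : ∀ {n} (r : ℕ) (π π* : Permutation′ n) → Fin n → ℚ
ΔΨ r π π* z = sumℚ (λ w → Ψelt r (posAfterFetch π z w) (pos π* w) - Ψelt r (pos π w) (pos π* w))

ΔΦothers : ∀ {n} (r : ℕ) (π π* : Permutation′ n) (b : Fin n → ℚ) → Fin n → ℚ
ΔΦothers r π π* b z = sumℚ (λ w → f w (w ≟ z))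
  where
  f : (w : Fin _) → Dec (w ≡ z) → ℚ
  f w (yes _) = 0ℚ
  f w (no _)  = Φelt r (posAfterFetch π z w) (pos π* w) (budgetAfterFetch b z w)
              - Φelt r (pos π w) (pos π* w) (b w)

-- ΔDLM: cost of fetch(z) = π(z) - 1 adjacent swaps
ΔDLM : ∀ {n} → Permutation′ n → Fin n → ℚ
ΔDLM π z = ℕ→ℚ (pos π z ∸ 1)

{-# OPTIONS --safe #-}
module Submission where

-- Fetching z moves only the elements that preceded it, each back by one position, and
-- takes z to position 1, which can only lower Ψ_z. For a moved element w write
-- π(w) = 2^p + q and A = p*(w) + κ. If p < A, neither Ψ_w nor Φ_w changes. If p ≥ A,
-- Ψ_w + Φ_w grows by at most 3β: inside a dyadic block Ψ_w grows by 2β and Φ_w by at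
-- most β, and when π(w) + 1 is a power of two the drop 2βq of Ψ_w pays for the jump of
-- Φ_w to βπ(w) − γb(w). In the second case π*(w)·2^κ < 2π(w) < 2π(z), so by injectivity
-- of π* at most 2π(z)/2^κ elements contribute, and 2^κ ≥ 6β bounds their total by π(z).
-- Together with the cost π(z) − 1 of the fetch this gives 2π(z).

open import Defs
open import Data.Nat using (ℕ)
open import Data.Fin using (Fin)
open import Data.Fin.Permutation using (Permutation′)
open import Data.Rational using (ℚ)

module BinaryExponent where
  open import Data.Nat
  open import Data.Nat.Properties
  open import Data.Nat.DivMod using (_/_; m*n/n≡m; /-monoˡ-≤)
  open import Data.Nat.Induction using (<-rec)
  open import Data.Nat.Logarithm using (⌊log₂_⌋; ⌈log₂_⌉; ⌊log₂[2^n]⌋≡n)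
  open import Data.Nat.Logarithm.Core using (⌊log2⌋-acc-irrelevant; ⌈log2⌉-acc-irrelevant)
  open import Data.Sum using (_⊎_; inj₁; inj₂)
  open import Relation.Binary.PropositionalEquality
  open ≤-Reasoning

  2*⌊n/2⌋≤n : ∀ n → 2 * ⌊ n /2⌋ ≤ n
  2*⌊n/2⌋≤n zero          = z≤n
  2*⌊n/2⌋≤n (suc zero)    = z≤n
  2*⌊n/2⌋≤n (suc (suc n)) rewrite *-suc 2 ⌊ n /2⌋ = s≤s (s≤s (2*⌊n/2⌋≤n n))

  n≤1+2*⌊n/2⌋ : ∀ n → n ≤ suc (2 * ⌊ n /2⌋)
  n≤1+2*⌊n/2⌋ zero          = z≤n
  n≤1+2*⌊n/2⌋ (suc zero)    = ≤-refl
  n≤1+2*⌊n/2⌋ (suc (suc n)) rewrite *-suc 2 ⌊ n /2⌋ = s≤s (s≤s (n≤1+2*⌊n/2⌋ n))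

  n≤2*⌈n/2⌉ : ∀ n → n ≤ 2 * ⌈ n /2⌉
  n≤2*⌈n/2⌉ n = ≤-pred (n≤1+2*⌊n/2⌋ (suc n))

  ⌊log₂[2+n]⌋≡1+⌊log₂⌊2+n/2⌋⌋ : ∀ n → ⌊log₂ (2 + n) ⌋ ≡ suc ⌊log₂ ⌊ 2 + n /2⌋ ⌋
  ⌊log₂[2+n]⌋≡1+⌊log₂⌊2+n/2⌋⌋ n = cong suc (⌊log2⌋-acc-irrelevant (suc ⌊ n /2⌋))

  ⌈log₂[2+n]⌉≡1+⌈log₂⌈2+n/2⌉⌉ : ∀ n → ⌈log₂ (2 + n) ⌉ ≡ suc ⌈log₂ ⌈ 2 + n /2⌉ ⌉
  ⌈log₂[2+n]⌉≡1+⌈log₂⌈2+n/2⌉⌉ n = cong suc (⌈log2⌉-acc-irrelevant (suc ⌈ n /2⌉))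

  2^⌊log₂[1+n]⌋≤1+n : ∀ n → 2 ^ ⌊log₂ suc n ⌋ ≤ suc n
  2^⌊log₂[1+n]⌋≤1+n = <-rec _ step
    where
    step : ∀ n → (∀ {m} → m < n → 2 ^ ⌊log₂ suc m ⌋ ≤ suc m) → 2 ^ ⌊log₂ suc n ⌋ ≤ suc n
    step zero    _   = ≤-refl
    step (suc n) rec = begin
      2 ^ ⌊log₂ (2 + n) ⌋       ≡⟨ cong (2 ^_) (⌊log₂[2+n]⌋≡1+⌊log₂⌊2+n/2⌋⌋ n) ⟩
      2 * 2 ^ ⌊log₂ h ⌋         ≤⟨ *-monoʳ-≤ 2 (rec (s≤s (⌊n/2⌋≤n n))) ⟩
      2 * h                     ≤⟨ 2*⌊n/2⌋≤n (2 + n) ⟩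
      2 + n                     ∎
      where h = ⌊ 2 + n /2⌋

  n<2^[1+⌊log₂n⌋] : ∀ n → n < 2 ^ suc ⌊log₂ n ⌋
  n<2^[1+⌊log₂n⌋] = <-rec _ step
    where
    step : ∀ n → (∀ {m} → m < n → m < 2 ^ suc ⌊log₂ m ⌋) → n < 2 ^ suc ⌊log₂ n ⌋
    step zero          _   = s≤s z≤n
    step (suc zero)    _   = s≤s (s≤s z≤n)
    step (suc (suc n)) rec = begin-strict
      2 + n                     ≤⟨ n≤1+2*⌊n/2⌋ (2 + n) ⟩
      suc (2 * h)               <⟨ n<1+n _ ⟩
      2 + 2 * h                 ≡⟨ *-suc 2 h ⟨
      2 * suc h                 ≤⟨ *-monoʳ-≤ 2 (rec (⌊n/2⌋<n (suc n))) ⟩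
      2 * 2 ^ suc ⌊log₂ h ⌋     ≡⟨ cong (λ e → 2 ^ suc e) (sym (⌊log₂[2+n]⌋≡1+⌊log₂⌊2+n/2⌋⌋ n)) ⟩
      2 ^ suc ⌊log₂ (2 + n) ⌋   ∎
      where h = ⌊ 2 + n /2⌋

  n≤2^⌈log₂n⌉ : ∀ n → n ≤ 2 ^ ⌈log₂ n ⌉
  n≤2^⌈log₂n⌉ = <-rec _ step
    where
    step : ∀ n → (∀ {m} → m < n → m ≤ 2 ^ ⌈log₂ m ⌉) → n ≤ 2 ^ ⌈log₂ n ⌉
    step zero          _   = z≤n
    step (suc zero)    _   = ≤-refl
    step (suc (suc n)) rec = begin
      2 + n                     ≤⟨ n≤2*⌈n/2⌉ (2 + n) ⟩
      2 * h                     ≤⟨ *-monoʳ-≤ 2 (rec (⌈n/2⌉<n n)) ⟩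
      2 * 2 ^ ⌈log₂ h ⌉         ≡⟨ cong (2 ^_) (sym (⌈log₂[2+n]⌉≡1+⌈log₂⌈2+n/2⌉⌉ n)) ⟩
      2 ^ ⌈log₂ (2 + n) ⌉       ∎
      where h = ⌈ 2 + n /2⌉

  2^-cancel-< : ∀ {a b} → 2 ^ a < 2 ^ b → a < b
  2^-cancel-< 2^a<2^b = ≰⇒> (λ b≤a → <⇒≱ 2^a<2^b (^-monoʳ-≤ 2 b≤a))

  p-unique : ∀ {a n} → 2 ^ a ≤ suc n → suc n < 2 ^ suc a → p (suc n) ≡ a
  p-unique {a} {n} 2^a≤ <2^[1+a] = ≤-antisym
    (≤-pred (2^-cancel-< (≤-<-trans (2^⌊log₂[1+n]⌋≤1+n n) <2^[1+a])))
    (≤-pred (2^-cancel-< (≤-<-trans 2^a≤ (n<2^[1+⌊log₂n⌋] (suc n)))))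

  data Increment (x : ℕ) : Set where
    same-exponent : p (suc x) ≡ p x → q (suc x) ≡ suc (q x) → Increment x
    next-exponent : p (suc x) ≡ suc (p x) → q (suc x) ≡ 0 → suc x ≡ 2 * suc (q x) → Increment x

  increment : ∀ k → Increment (suc k)
  increment k = classify (m≤n⇒m<n∨m≡n (n<2^[1+⌊log₂n⌋] x))
    where
    x = suc k
    2^p≤x : 2 ^ p x ≤ x
    2^p≤x = 2^⌊log₂[1+n]⌋≤1+n k
    classify : suc x < 2 ^ suc (p x) ⊎ suc x ≡ 2 ^ suc (p x) → Increment x
    classify (inj₁ 1+x<2^[1+p]) = same-exponent p-same q-suc
      where
      p-same : p (suc x) ≡ p x
      p-same = p-unique (≤-trans 2^p≤x (n≤1+n x)) 1+x<2^[1+p]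
      q-suc : q (suc x) ≡ suc (q x)
      q-suc = trans (cong (λ e → suc x ∸ 2 ^ e) p-same) (+-∸-assoc 1 2^p≤x)
    classify (inj₂ 1+x≡2^[1+p]) = next-exponent p-next q-zero (trans 1+x≡2^[1+p] (cong (2 *_) 2^p≡1+q))
      where
      p-next : p (suc x) ≡ suc (p x)
      p-next = trans (cong p 1+x≡2^[1+p]) (⌊log₂[2^n]⌋≡n (suc (p x)))
      q-zero : q (suc x) ≡ 0
      q-zero = begin-equality
        suc x ∸ 2 ^ p (suc x)         ≡⟨ cong (λ e → suc x ∸ 2 ^ e) p-next ⟩
        suc x ∸ 2 ^ suc (p x)         ≡⟨ cong (_∸ 2 ^ suc (p x)) 1+x≡2^[1+p] ⟩
        2 ^ suc (p x) ∸ 2 ^ suc (p x) ≡⟨ n∸n≡0 (2 ^ suc (p x)) ⟩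
        0                             ∎
      2^p≡1+q : 2 ^ p x ≡ suc (q x)
      2^p≡1+q = begin-equality
        2 ^ p x                       ≡⟨ +-identityʳ _ ⟨
        2 ^ p x + 0                   ≡⟨ m+n∸m≡n (2 ^ p x) _ ⟨
        2 * 2 ^ p x ∸ 2 ^ p x         ≡⟨ cong (_∸ 2 ^ p x) 1+x≡2^[1+p] ⟨
        suc x ∸ 2 ^ p x               ≡⟨ +-∸-assoc 1 2^p≤x ⟩
        suc (q x)                     ∎

  m*n≤o⇒m≤o/n : ∀ m {n o} .{{_ : NonZero n}} → m * n ≤ o → m ≤ o / n
  m*n≤o⇒m≤o/n m {n} m*n≤o = subst (_≤ _ / n) (m*n/n≡m m n) (/-monoˡ-≤ n m*n≤o)

  p[y]+k≤p[x]⇒y*2^k<2*x : ∀ x y k → p (suc y) + k ≤ p (suc x) → suc y * 2 ^ k < 2 * suc x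
  p[y]+k≤p[x]⇒y*2^k<2*x x y k gap = begin-strict
    suc y * 2 ^ k                 <⟨ *-monoˡ-< (2 ^ k) {{m^n≢0 2 k}} (n<2^[1+⌊log₂n⌋] (suc y)) ⟩
    2 ^ suc (p (suc y)) * 2 ^ k   ≡⟨ ^-distribˡ-+-* 2 (suc (p (suc y))) k ⟨
    2 ^ suc (p (suc y) + k)       ≤⟨ ^-monoʳ-≤ 2 (s≤s gap) ⟩
    2 * 2 ^ p (suc x)             ≤⟨ *-monoʳ-≤ 2 (2^⌊log₂[1+n]⌋≤1+n x) ⟩
    2 * suc x                     ∎

module Conditional where
  open import Data.Bool using (Bool; true; false; T; if_then_else_)
  open import Data.Unit using (tt)
  open import Relation.Nullary using (¬_; contradiction)
  open import Relation.Binary.PropositionalEquality using (_≡_; refl)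

  if-T : ∀ {A : Set} {c : Bool} {x y : A} → T c → (if c then x else y) ≡ x
  if-T {c = true} _ = refl

  if-¬T : ∀ {A : Set} {c : Bool} {x y : A} → ¬ T c → (if c then x else y) ≡ y
  if-¬T {c = false} _   = refl
  if-¬T {c = true}  ¬tt = contradiction tt ¬tt

  if-elim : ∀ {A : Set} (P : A → Set) (c : Bool) {x y : A} → P x → P y → P (if c then x else y)
  if-elim P true  px _  = px
  if-elim P false _  py = py

module RationalFacts where
  import Data.Nat as ℕ
  import Data.Nat.Properties as ℕ
  open import Data.Integer as ℤ using (+_)
  import Data.Integer.Properties as ℤ
  import Data.Integer.Solver as ℤ-Solver
  import Data.Rational.Solver as ℚ-Solver
  open import Data.Rational.Properties
  open import Data.Rational hiding (_≃_; *≡*)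
  open import Data.Rational.Unnormalised as ℚᵘ using (mkℚᵘ; _≃_; *≡*)
  import Data.Rational.Unnormalised.Properties as ℚᵘ
  open import Relation.Binary.PropositionalEquality

  toℚᵘ-ℕ→ℚ : ∀ k → toℚᵘ (ℕ→ℚ k) ≃ mkℚᵘ (+ k) 0
  toℚᵘ-ℕ→ℚ k = toℚᵘ-fromℚᵘ (mkℚᵘ (+ k) 0)

  ℕ→ℚ-+ : ∀ m n → ℕ→ℚ (m ℕ.+ n) ≡ ℕ→ℚ m + ℕ→ℚ n
  ℕ→ℚ-+ m n = toℚᵘ-injective (begin
    toℚᵘ (ℕ→ℚ (m ℕ.+ n))                ≈⟨ toℚᵘ-ℕ→ℚ (m ℕ.+ n) ⟩
    mkℚᵘ (+ (m ℕ.+ n)) 0                ≈⟨ *≡* (trans (cong (ℤ._* + 1) (ℤ.pos-+ m n)) (solve 2 (λ a b → (a :+ b) :* con (+ 1) := (a :* con (+ 1) :+ b :* con (+ 1)) :* con (+ 1)) refl (+ m) (+ n))) ⟩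
    mkℚᵘ (+ m) 0 ℚᵘ.+ mkℚᵘ (+ n) 0      ≈⟨ ℚᵘ.+-cong (toℚᵘ-ℕ→ℚ m) (toℚᵘ-ℕ→ℚ n) ⟨
    toℚᵘ (ℕ→ℚ m) ℚᵘ.+ toℚᵘ (ℕ→ℚ n)      ≈⟨ toℚᵘ-homo-+ (ℕ→ℚ m) (ℕ→ℚ n) ⟨
    toℚᵘ (ℕ→ℚ m + ℕ→ℚ n)                ∎)
    where
    open ℚᵘ.≃-Reasoning
    open ℤ-Solver.+-*-Solver

  ℕ→ℚ-* : ∀ m n → ℕ→ℚ (m ℕ.* n) ≡ ℕ→ℚ m * ℕ→ℚ n
  ℕ→ℚ-* m n = toℚᵘ-injective (begin
    toℚᵘ (ℕ→ℚ (m ℕ.* n))                ≈⟨ toℚᵘ-ℕ→ℚ (m ℕ.* n) ⟩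
    mkℚᵘ (+ (m ℕ.* n)) 0                ≈⟨ *≡* (cong (ℤ._* + 1) (ℤ.pos-* m n)) ⟩
    mkℚᵘ (+ m) 0 ℚᵘ.* mkℚᵘ (+ n) 0      ≈⟨ ℚᵘ.*-cong (toℚᵘ-ℕ→ℚ m) (toℚᵘ-ℕ→ℚ n) ⟨
    toℚᵘ (ℕ→ℚ m) ℚᵘ.* toℚᵘ (ℕ→ℚ n)      ≈⟨ toℚᵘ-homo-* (ℕ→ℚ m) (ℕ→ℚ n) ⟨
    toℚᵘ (ℕ→ℚ m * ℕ→ℚ n)                ∎)
    where open ℚᵘ.≃-Reasoning

  2*β≡15r+10 : ∀ r → ℕ→ℚ 2 * β r ≡ ℕ→ℚ (15 ℕ.* r ℕ.+ 10)
  2*β≡15r+10 r = toℚᵘ-injective (begin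
    toℚᵘ (ℕ→ℚ 2 * β r)                  ≈⟨ toℚᵘ-homo-* (ℕ→ℚ 2) (β r) ⟩
    toℚᵘ (ℕ→ℚ 2) ℚᵘ.* toℚᵘ (β r)         ≈⟨ ℚᵘ.*-cong (toℚᵘ-ℕ→ℚ 2) (toℚᵘ-fromℚᵘ (mkℚᵘ (+ s) 1)) ⟩
    mkℚᵘ (+ 2) 0 ℚᵘ.* mkℚᵘ (+ s) 1      ≈⟨ *≡* (solve 1 (λ a → (con (+ 2) :* a) :* con (+ 1) := a :* con (+ 2)) refl (+ s)) ⟩
    mkℚᵘ (+ s) 0                        ≈⟨ toℚᵘ-ℕ→ℚ s ⟨
    toℚᵘ (ℕ→ℚ s)                        ∎)
    where
    s = 15 ℕ.* r ℕ.+ 10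
    open ℚᵘ.≃-Reasoning
    open ℤ-Solver.+-*-Solver

  x+x≡2*x : ∀ x → x + x ≡ ℕ→ℚ 2 * x
  x+x≡2*x x = trans (solve 1 (λ a → a :+ a := (con 1ℚ :+ con 1ℚ) :* a) refl x) (cong (_* x) (ℕ→ℚ-+ 1 1))
    where open ℚ-Solver.+-*-Solver

  ℕ→ℚ-nonNeg : ∀ k → 0ℚ ≤ ℕ→ℚ k
  ℕ→ℚ-nonNeg k = nonNegative⁻¹ (ℕ→ℚ k) {{normalize-nonNeg k 1}}

  β-nonNeg : ∀ r → 0ℚ ≤ β r
  β-nonNeg r = nonNegative⁻¹ (β r) {{normalize-nonNeg (15 ℕ.* r ℕ.+ 10) 2}}

  *-nonNeg : ∀ {x y} → 0ℚ ≤ x → 0ℚ ≤ y → 0ℚ ≤ x * y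
  *-nonNeg {x} {y} 0≤x 0≤y =
    nonNegative⁻¹ (x * y) {{nonNeg*nonNeg⇒nonNeg x {{nonNegative 0≤x}} y {{nonNegative 0≤y}}}}

  x≤x+y : ∀ {x y} → 0ℚ ≤ y → x ≤ x + y
  x≤x+y {x} 0≤y = ≤-trans (≤-reflexive (sym (+-identityʳ x))) (+-monoʳ-≤ x 0≤y)

  x-y≤x : ∀ {x y} → 0ℚ ≤ y → x - y ≤ x
  x-y≤x {x} 0≤y = ≤-trans (+-monoʳ-≤ x (neg-antimono-≤ 0≤y)) (≤-reflexive (+-identityʳ x))

  ℕ→ℚ-mono-≤ : ∀ {m n} → m ℕ.≤ n → ℕ→ℚ m ≤ ℕ→ℚ n
  ℕ→ℚ-mono-≤ {m} {n} m≤n = begin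
    ℕ→ℚ m                     ≤⟨ x≤x+y (ℕ→ℚ-nonNeg (n ℕ.∸ m)) ⟩
    ℕ→ℚ m + ℕ→ℚ (n ℕ.∸ m)     ≡⟨ ℕ→ℚ-+ m (n ℕ.∸ m) ⟨
    ℕ→ℚ (m ℕ.+ (n ℕ.∸ m))     ≡⟨ cong ℕ→ℚ (ℕ.m+[n∸m]≡n m≤n) ⟩
    ℕ→ℚ n                     ∎
    where open ≤-Reasoning

module Sums where
  open import Data.Nat using (zero; suc; _<ᵇ_)
  open import Data.Fin using (Fin; zero; suc; toℕ)
  open import Data.Fin.Permutation using (Permutation′; _⟨$⟩ʳ_)
  open import Data.Bool using (if_then_else_)
  open import Data.Rational
  open import Data.Rational.Properties
  open import Algebra.Properties.CommutativeMonoid.Sum +-0-commutativeMonoid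
    using (sum; ∑-distrib-+; sum-permute)
  open import Relation.Binary.PropositionalEquality
  open RationalFacts

  sumℚ≡sum : ∀ {n} (f : Fin n → ℚ) → sumℚ f ≡ sum f
  sumℚ≡sum {zero}  f = refl
  sumℚ≡sum {suc n} f = cong (f zero +_) (sumℚ≡sum (λ i → f (suc i)))

  sumℚ-+ : ∀ {n} (f g : Fin n → ℚ) → sumℚ f + sumℚ g ≡ sumℚ (λ i → f i + g i)
  sumℚ-+ f g = begin
    sumℚ f + sumℚ g               ≡⟨ cong₂ _+_ (sumℚ≡sum f) (sumℚ≡sum g) ⟩
    sum f + sum g                 ≡⟨ ∑-distrib-+ f g ⟨
    sum (λ i → f i + g i)         ≡⟨ sumℚ≡sum (λ i → f i + g i) ⟨
    sumℚ (λ i → f i + g i)        ∎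
    where open ≡-Reasoning

  sumℚ-permute : ∀ {n} (f : Fin n → ℚ) (π : Permutation′ n) → sumℚ (λ w → f (π ⟨$⟩ʳ w)) ≡ sumℚ f
  sumℚ-permute f π = begin
    sumℚ (λ w → f (π ⟨$⟩ʳ w))     ≡⟨ sumℚ≡sum (λ w → f (π ⟨$⟩ʳ w)) ⟩
    sum (λ w → f (π ⟨$⟩ʳ w))      ≡⟨ sum-permute f π ⟨
    sum f                         ≡⟨ sumℚ≡sum f ⟨
    sumℚ f                        ∎
    where open ≡-Reasoning

  sumℚ-mono-≤ : ∀ {n} {f g : Fin n → ℚ} → (∀ i → f i ≤ g i) → sumℚ f ≤ sumℚ g
  sumℚ-mono-≤ {zero}  f≤g = ≤-refl
  sumℚ-mono-≤ {suc n} f≤g = +-mono-≤ (f≤g zero) (sumℚ-mono-≤ (λ i → f≤g (suc i)))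

  sumℚ-below-≤ : ∀ {n} m {c} → 0ℚ ≤ c → sumℚ {n} (λ i → if toℕ i <ᵇ m then c else 0ℚ) ≤ ℕ→ℚ m * c
  sumℚ-below-≤ {zero}  m       0≤c = *-nonNeg (ℕ→ℚ-nonNeg m) 0≤c
  sumℚ-below-≤ {suc n} zero {c} 0≤c = begin
    0ℚ + sumℚ {n} (λ _ → 0ℚ)      ≡⟨ +-identityˡ _ ⟩
    sumℚ {n} (λ _ → 0ℚ)           ≤⟨ sumℚ-below-≤ {n} zero 0≤c ⟩
    ℕ→ℚ 0 * c                     ∎
    where open ≤-Reasoning
  sumℚ-below-≤ {suc n} (suc m) {c} 0≤c = begin
    c + sumℚ {n} (λ i → if toℕ i <ᵇ m then c else 0ℚ) ≤⟨ +-monoʳ-≤ c (sumℚ-below-≤ {n} m 0≤c) ⟩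
    c + ℕ→ℚ m * c                                      ≡⟨ cong (_+ ℕ→ℚ m * c) (*-identityˡ c) ⟨
    1ℚ * c + ℕ→ℚ m * c                                 ≡⟨ *-distribʳ-+ c 1ℚ (ℕ→ℚ m) ⟨
    (1ℚ + ℕ→ℚ m) * c                                   ≡⟨ cong (_* c) (ℕ→ℚ-+ 1 m) ⟨
    ℕ→ℚ (suc m) * c                                    ∎
    where open ≤-Reasoning

module Fetch {n : ℕ} (π : Permutation′ n) (z : Fin n) where
  open import Data.Nat using (suc; _<_)
  open import Data.Nat.Properties using (<⇒<ᵇ; <ᵇ⇒<)
  open import Data.Fin using (_≟_)
  open import Relation.Nullary using (¬_; yes; no; contradiction)
  open import Relation.Binary.PropositionalEquality using (_≡_; _≢_; refl)
  open Conditional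

  posAfterFetch-self : posAfterFetch π z z ≡ 1
  posAfterFetch-self with z ≟ z
  ... | yes _   = refl
  ... | no z≢z = contradiction refl z≢z

  posAfterFetch-before : ∀ {w} → w ≢ z → pos π w < pos π z → posAfterFetch π z w ≡ suc (pos π w)
  posAfterFetch-before {w} w≢z w<z with w ≟ z
  ... | yes w≡z = contradiction w≡z w≢z
  ... | no _    = if-T (<⇒<ᵇ w<z)

  posAfterFetch-after : ∀ {w} → w ≢ z → ¬ pos π w < pos π z → posAfterFetch π z w ≡ pos π w
  posAfterFetch-after {w} w≢z w≮z with w ≟ z
  ... | yes w≡z = contradiction w≡z w≢z
  ... | no _    = if-¬T (λ w<ᵇz → w≮z (<ᵇ⇒< _ _ w<ᵇz))

  budgetAfterFetch-other : ∀ (b : Fin n → ℚ) {w} → w ≢ z → budgetAfterFetch b z w ≡ b w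
  budgetAfterFetch-other b {w} w≢z with w ≟ z
  ... | yes w≡z = contradiction w≡z w≢z
  ... | no _    = refl

module Potential (r y : ℕ) (b : ℚ) where
  open import Data.Sum using ([_,_]′)
  open import Data.Nat as ℕ using (suc)
  import Data.Nat.Properties as ℕ
  open import Data.Nat.Logarithm using (⌊log₂⌋-mono-≤)
  open import Data.Rational
  open import Data.Rational.Properties
  open import Data.Rational.Solver using (module +-*-Solver)
  open import Relation.Binary.PropositionalEquality
  open Conditional
  open RationalFacts
  open BinaryExponent using (Increment; same-exponent; next-exponent; increment)
  open +-*-Solver

  -- Cold and hot name the two branches of Ψelt and Φelt, split at the threshold A.
  A : ℕ
  A = p y ℕ.+ κ r

  Ψ Φ : ℕ → ℚ
  Ψ k = Ψelt r k y
  Φ k = Φelt r k y b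

  two*β : ℚ
  two*β = ℕ→ℚ 2 * β r

  3*β≡2*β+β : ℕ→ℚ 3 * β r ≡ two*β + β r
  3*β≡2*β+β = trans (cong (_* β r) (ℕ→ℚ-+ 2 1)) (solve 2 (λ T B → (T :+ con 1ℚ) :* B := T :* B :+ B) refl (ℕ→ℚ 2) (β r))

  Ψ-cold : ∀ k → p k ℕ.< A → Ψ k ≡ 0ℚ
  Ψ-cold k pk<A = if-T (ℕ.≤⇒≤ᵇ (subst (ℕ._≤ A) (ℕ.+-comm 1 (p k)) pk<A))

  Ψ-hot : ∀ k → A ℕ.≤ p k → Ψ k ≡ ℕ→ℚ 2 * β r * ℕ→ℚ (q k)
  Ψ-hot k A≤pk = if-¬T λ t →
    ℕ.<-irrefl refl (subst (ℕ._≤ p k) (ℕ.+-comm (p k) 1) (ℕ.≤-trans (ℕ.≤ᵇ⇒≤ (p k ℕ.+ 1) A t) A≤pk))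

  Φ-cold : ∀ k → p k ℕ.≤ A → Φ k ≡ α * b
  Φ-cold k pk≤A = if-T (ℕ.≤⇒≤ᵇ pk≤A)

  Φ-hot : ∀ k → A ℕ.< p k → Φ k ≡ β r * ℕ→ℚ k - γ r * b
  Φ-hot k A<pk = if-¬T (λ t → ℕ.<⇒≱ A<pk (ℕ.≤ᵇ⇒≤ (p k) A t))

  Ψ-q≡0 : ∀ k → q k ≡ 0 → Ψ k ≡ 0ℚ
  Ψ-q≡0 k qk≡0 = [ Ψ-cold k , hot ]′ (ℕ.<-≤-connex (p k) A)
    where
    hot : A ℕ.≤ p k → Ψ k ≡ 0ℚ
    hot A≤pk = begin
      Ψ k                       ≡⟨ Ψ-hot k A≤pk ⟩
      two*β * ℕ→ℚ (q k)         ≡⟨ cong (λ j → two*β * ℕ→ℚ j) qk≡0 ⟩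
      two*β * 0ℚ                ≡⟨ *-zeroʳ two*β ⟩
      0ℚ                        ∎
      where open ≡-Reasoning

  Ψ-nonNeg : ∀ k → 0ℚ ≤ Ψ k
  Ψ-nonNeg k = [ cold , hot ]′ (ℕ.<-≤-connex (p k) A)
    where
    cold : p k ℕ.< A → 0ℚ ≤ Ψ k
    cold pk<A = ≤-reflexive (sym (Ψ-cold k pk<A))
    hot : A ℕ.≤ p k → 0ℚ ≤ Ψ k
    hot A≤pk = subst (0ℚ ≤_) (sym (Ψ-hot k A≤pk))
      (*-nonNeg (*-nonNeg (ℕ→ℚ-nonNeg 2) (β-nonNeg r)) (ℕ→ℚ-nonNeg (q k)))

  Φ-α*b≤β*k : 0ℚ ≤ b → ∀ k → Φ k - α * b ≤ β r * ℕ→ℚ k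
  Φ-α*b≤β*k 0≤b k = [ cold , hot ]′ (ℕ.≤-<-connex (p k) A)
    where
    open ≤-Reasoning
    cold : p k ℕ.≤ A → Φ k - α * b ≤ β r * ℕ→ℚ k
    cold pk≤A = begin
      Φ k - α * b               ≡⟨ cong (_- α * b) (Φ-cold k pk≤A) ⟩
      α * b - α * b             ≡⟨ +-inverseʳ (α * b) ⟩
      0ℚ                        ≤⟨ *-nonNeg (β-nonNeg r) (ℕ→ℚ-nonNeg k) ⟩
      β r * ℕ→ℚ k               ∎
    hot : A ℕ.< p k → Φ k - α * b ≤ β r * ℕ→ℚ k
    hot A<pk = begin
      Φ k - α * b                   ≡⟨ cong (_- α * b) (Φ-hot k A<pk) ⟩
      β r * ℕ→ℚ k - γ r * b - α * b ≤⟨ x-y≤x (*-nonNeg (ℕ→ℚ-nonNeg 2) 0≤b) ⟩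
      β r * ℕ→ℚ k - γ r * b         ≤⟨ x-y≤x (*-nonNeg (ℕ→ℚ-nonNeg (5 ℕ.* r)) 0≤b) ⟩
      β r * ℕ→ℚ k                   ∎

  ΔΦ-cold : ∀ x → p (suc x) ℕ.≤ A → Φ (suc x) - Φ x ≡ 0ℚ
  ΔΦ-cold x p[1+x]≤A = begin
    Φ (suc x) - Φ x           ≡⟨ cong₂ _-_ (Φ-cold (suc x) p[1+x]≤A) (Φ-cold x (ℕ.≤-trans (⌊log₂⌋-mono-≤ (ℕ.n≤1+n x)) p[1+x]≤A)) ⟩
    α * b - α * b             ≡⟨ +-inverseʳ (α * b) ⟩
    0ℚ                        ∎
    where open ≡-Reasoning

  ΔΦ-hot : ∀ x → A ℕ.< p x → Φ (suc x) - Φ x ≡ β r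
  ΔΦ-hot x A<px = begin
    Φ (suc x) - Φ x           ≡⟨ cong₂ _-_ (Φ-hot (suc x) (ℕ.<-≤-trans A<px (⌊log₂⌋-mono-≤ (ℕ.n≤1+n x)))) (Φ-hot x A<px) ⟩
    (β r * ℕ→ℚ (suc x) - γ r * b) - (β r * ℕ→ℚ x - γ r * b)
      ≡⟨ cong (λ s → (β r * s - γ r * b) - (β r * ℕ→ℚ x - γ r * b)) (ℕ→ℚ-+ 1 x) ⟩
    (β r * (1ℚ + ℕ→ℚ x) - γ r * b) - (β r * ℕ→ℚ x - γ r * b)
      ≡⟨ solve 4 (λ B X G c → (B :* (con 1ℚ :+ X) :- G :* c) :- (B :* X :- G :* c) := B) refl (β r) (ℕ→ℚ x) (γ r) b ⟩
    β r                       ∎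
    where open ≡-Reasoning

  ΔΦ≤β : ∀ x → p (suc x) ≡ p x → Φ (suc x) - Φ x ≤ β r
  ΔΦ≤β x p[1+x]≡px = [ cold , (λ A<px → ≤-reflexive (ΔΦ-hot x A<px)) ]′ (ℕ.≤-<-connex (p x) A)
    where
    cold : p x ℕ.≤ A → Φ (suc x) - Φ x ≤ β r
    cold px≤A = ≤-trans (≤-reflexive (ΔΦ-cold x (subst (ℕ._≤ A) (sym p[1+x]≡px) px≤A))) (β-nonNeg r)

  ΔΦ≤β*[1+x] : 0ℚ ≤ b → ∀ x → Φ (suc x) - Φ x ≤ β r * ℕ→ℚ (suc x)
  ΔΦ≤β*[1+x] 0≤b x = [ cold , hot ]′ (ℕ.≤-<-connex (p x) A)
    where
    open ≤-Reasoning
    cold : p x ℕ.≤ A → Φ (suc x) - Φ x ≤ β r * ℕ→ℚ (suc x)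
    cold px≤A = begin
      Φ (suc x) - Φ x           ≡⟨ cong (λ t → Φ (suc x) - t) (Φ-cold x px≤A) ⟩
      Φ (suc x) - α * b         ≤⟨ Φ-α*b≤β*k 0≤b (suc x) ⟩
      β r * ℕ→ℚ (suc x)         ∎
    hot : A ℕ.< p x → Φ (suc x) - Φ x ≤ β r * ℕ→ℚ (suc x)
    hot A<px = begin
      Φ (suc x) - Φ x           ≡⟨ ΔΦ-hot x A<px ⟩
      β r                       ≤⟨ x≤x+y (*-nonNeg (β-nonNeg r) (ℕ→ℚ-nonNeg x)) ⟩
      β r + β r * ℕ→ℚ x         ≡⟨ solve 2 (λ B X → B :+ B :* X := B :* (con 1ℚ :+ X)) refl (β r) (ℕ→ℚ x) ⟩
      β r * (1ℚ + ℕ→ℚ x)        ≡⟨ cong (β r *_) (ℕ→ℚ-+ 1 x) ⟨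
      β r * ℕ→ℚ (suc x)         ∎

  Δ : ℕ → ℕ → ℚ
  Δ a x = (Ψ a - Ψ x) + (Φ a - Φ x)

  Δ-refl : ∀ x → Δ x x ≡ 0ℚ
  Δ-refl x = cong₂ _+_ (+-inverseʳ (Ψ x)) (+-inverseʳ (Φ x))

  Δ-suc-cold : ∀ k → p (suc k) ℕ.< A → Δ (suc (suc k)) (suc k) ≡ 0ℚ
  Δ-suc-cold k px<A = by-increment (increment k)
    where
    x = suc k
    by-increment : Increment x → Δ (suc x) x ≡ 0ℚ
    by-increment (same-exponent p[1+x]≡px _) = cong₂ _+_
      (cong₂ _-_ (Ψ-cold (suc x) (subst (ℕ._< A) (sym p[1+x]≡px) px<A)) (Ψ-cold x px<A))
      (ΔΦ-cold x (subst (ℕ._≤ A) (sym p[1+x]≡px) (ℕ.<⇒≤ px<A)))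
    by-increment (next-exponent p[1+x]≡1+px q[1+x]≡0 _) = cong₂ _+_
      (cong₂ _-_ (Ψ-q≡0 (suc x) q[1+x]≡0) (Ψ-cold x px<A))
      (ΔΦ-cold x (subst (ℕ._≤ A) (sym p[1+x]≡1+px) px<A))

  Δ-suc-hot : 0ℚ ≤ b → ∀ k → A ℕ.≤ p (suc k) → Δ (suc (suc k)) (suc k) ≤ ℕ→ℚ 3 * β r
  Δ-suc-hot 0≤b k A≤px = by-increment (increment k)
    where
    x = suc k
    Q = ℕ→ℚ (q x)
    open ≤-Reasoning
    by-increment : Increment x → Δ (suc x) x ≤ ℕ→ℚ 3 * β r
    by-increment (same-exponent p[1+x]≡px q[1+x]≡1+qx) = begin
      (Ψ (suc x) - Ψ x) + (Φ (suc x) - Φ x)  ≤⟨ +-monoʳ-≤ (Ψ (suc x) - Ψ x) (ΔΦ≤β x p[1+x]≡px) ⟩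
      (Ψ (suc x) - Ψ x) + β r                ≡⟨ cong₂ (λ s t → (s - t) + β r) (Ψ-hot (suc x) (subst (A ℕ.≤_) (sym p[1+x]≡px) A≤px)) (Ψ-hot x A≤px) ⟩
      (two*β * ℕ→ℚ (q (suc x)) - two*β * Q) + β r
        ≡⟨ cong (λ s → (two*β * s - two*β * Q) + β r) (trans (cong ℕ→ℚ q[1+x]≡1+qx) (ℕ→ℚ-+ 1 (q x))) ⟩
      (two*β * (1ℚ + Q) - two*β * Q) + β r   ≡⟨ solve 3 (λ T B Q → (T :* (con 1ℚ :+ Q) :- T :* Q) :+ B := T :+ B) refl two*β (β r) Q ⟩
      two*β + β r                            ≡⟨ 3*β≡2*β+β ⟨
      ℕ→ℚ 3 * β r                            ∎
    by-increment (next-exponent _ q[1+x]≡0 1+x≡2[1+qx]) = begin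
      (Ψ (suc x) - Ψ x) + (Φ (suc x) - Φ x)  ≤⟨ +-monoʳ-≤ (Ψ (suc x) - Ψ x) (ΔΦ≤β*[1+x] 0≤b x) ⟩
      (Ψ (suc x) - Ψ x) + β r * ℕ→ℚ (suc x)  ≡⟨ cong₂ (λ s t → (s - t) + β r * ℕ→ℚ (suc x)) (Ψ-q≡0 (suc x) q[1+x]≡0) (Ψ-hot x A≤px) ⟩
      (0ℚ - two*β * Q) + β r * ℕ→ℚ (suc x)   ≡⟨ cong (λ s → (0ℚ - two*β * Q) + β r * s) 1+x≡2[1+Q] ⟩
      (0ℚ - two*β * Q) + β r * (ℕ→ℚ 2 * (1ℚ + Q))
        ≡⟨ solve 3 (λ T B Q → (con 0ℚ :- (T :* B) :* Q) :+ B :* (T :* (con 1ℚ :+ Q)) := T :* B) refl (ℕ→ℚ 2) (β r) Q ⟩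
      two*β                                  ≤⟨ x≤x+y (β-nonNeg r) ⟩
      two*β + β r                            ≡⟨ 3*β≡2*β+β ⟨
      ℕ→ℚ 3 * β r                            ∎
      where
      1+x≡2[1+Q] : ℕ→ℚ (suc x) ≡ ℕ→ℚ 2 * (1ℚ + Q)
      1+x≡2[1+Q] = trans (cong ℕ→ℚ 1+x≡2[1+qx]) (trans (ℕ→ℚ-* 2 (suc (q x))) (cong (ℕ→ℚ 2 *_) (ℕ→ℚ-+ 1 (q x))))

module FetchStep (r : ℕ) {n : ℕ} (π π* : Permutation′ n) (b : Fin n → ℚ) (z : Fin n) where
  open import Data.Nat as ℕ using (suc; _<ᵇ_)
  import Data.Nat.Properties as ℕ
  open import Data.Nat.Properties using (_<?_)
  open import Data.Nat.DivMod using (_/_; m/n*n≤m)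
  open import Data.Fin using (toℕ; _≟_)
  open import Data.Fin.Permutation using (_⟨$⟩ʳ_)
  open import Data.Bool using (if_then_else_)
  open import Data.Sum using ([_,_]′)
  open import Data.Rational using (ℚ; 0ℚ; _≤_; _+_; _-_; _*_; -_)
  open import Data.Rational.Properties
    using (≤-refl; ≤-trans; ≤-reflexive; +-identityˡ; +-identityʳ; neg-antimono-≤; *-cancelˡ-≤-pos; *-monoˡ-≤-nonNeg; normalize-nonNeg; module ≤-Reasoning)
  open import Data.Rational.Solver using (module +-*-Solver)
  open import Relation.Binary.Definitions using (DecidableEquality)
  open import Relation.Binary.PropositionalEquality
  open import Relation.Nullary using (Dec; yes; no; contradiction)
  open Conditional
  open RationalFacts
  open Sums
  open BinaryExponent using (m*n≤o⇒m≤o/n; p[y]+k≤p[x]⇒y*2^k<2*x; n≤2^⌈log₂n⌉)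
  open Fetch π z

  -- The summand of ΔΦothers is local to its definition. Abstracting the equality test
  -- turns it into a pattern, so that unification can name it.
  mutual
    ΔΦ-summand : Fin n → DecidableEquality (Fin n) → ℚ
    ΔΦ-summand = _

    ΔΦothers≡sum : ΔΦothers r π π* b z ≡ sumℚ (λ w → ΔΦ-summand w _≟_)
    ΔΦothers≡sum with _≟_ {n}
    ... | _ = refl

  ΔΦ-summand-self : ∀ (D : DecidableEquality (Fin n)) → ΔΦ-summand z D ≡ 0ℚ
  ΔΦ-summand-self D with D z z
  ... | yes _   = refl
  ... | no z≢z = contradiction refl z≢z

  ΔΦ-summand-other : ∀ (D : DecidableEquality (Fin n)) {w} → w ≢ z →
    ΔΦ-summand w D ≡ Φelt r (posAfterFetch π z w) (pos π* w) (budgetAfterFetch b z w) - Φelt r (pos π w) (pos π* w) (b w)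
  ΔΦ-summand-other D {w} w≢z with D w z
  ... | yes w≡z = contradiction w≡z w≢z
  ... | no _    = refl

  P K : ℕ
  P = pos π z
  K = 2 ℕ.^ κ r

  instance
    K≢0 : ℕ.NonZero K
    K≢0 = ℕ.m^n≢0 2 (κ r)

  hot-bound : ℕ
  hot-bound = 2 ℕ.* P / K

  below : ℕ → Fin n → ℚ
  below m i = if toℕ i <ᵇ m then ℕ→ℚ 3 * β r else 0ℚ

  bonus : Fin n → ℚ
  bonus w = below hot-bound (π* ⟨$⟩ʳ w)

  ψ : Fin n → ℚ
  ψ w = Ψelt r (posAfterFetch π z w) (pos π* w) - Ψelt r (pos π w) (pos π* w)

  change : Fin n → ℚ
  change w = ψ w + ΔΦ-summand w _≟_

  bonus-nonNeg : ∀ w → 0ℚ ≤ bonus w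
  bonus-nonNeg w = if-elim (0ℚ ≤_) (toℕ (π* ⟨$⟩ʳ w) <ᵇ hot-bound)
    (*-nonNeg (ℕ→ℚ-nonNeg 3) (β-nonNeg r)) ≤-refl

  hot-index : ∀ {w} → p (pos π* w) ℕ.+ κ r ℕ.≤ p (pos π w) → pos π w ℕ.< P → toℕ (π* ⟨$⟩ʳ w) ℕ.< hot-bound
  hot-index {w} gap w<z = m*n≤o⇒m≤o/n (pos π* w) {K} {2 ℕ.* P}
    (ℕ.≤-trans (ℕ.<⇒≤ (p[y]+k≤p[x]⇒y*2^k<2*x (toℕ (π ⟨$⟩ʳ w)) (toℕ (π* ⟨$⟩ʳ w)) (κ r) gap)) (ℕ.*-monoʳ-≤ 2 (ℕ.<⇒≤ w<z)))

  change-self : change z ≤ 0ℚ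
  change-self = begin
    (Ψ (posAfterFetch π z z) - Ψ P) + ΔΦ-summand z _≟_
      ≡⟨ cong₂ (λ a c → (Ψ a - Ψ P) + c) posAfterFetch-self (ΔΦ-summand-self _≟_) ⟩
    (Ψ 1 - Ψ P) + 0ℚ          ≡⟨ +-identityʳ _ ⟩
    Ψ 1 - Ψ P                 ≡⟨ cong (_- Ψ P) (Ψ-q≡0 1 refl) ⟩
    0ℚ - Ψ P                  ≡⟨ +-identityˡ _ ⟩
    - Ψ P                     ≤⟨ neg-antimono-≤ (Ψ-nonNeg P) ⟩
    0ℚ                        ∎
    where
    open Potential r (pos π* z) (b z) using (Ψ; Ψ-q≡0; Ψ-nonNeg)
    open ≤-Reasoning

  change-other : ∀ {w} → w ≢ z → change w ≡ Potential.Δ r (pos π* w) (b w) (posAfterFetch π z w) (pos π w)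
  change-other {w} w≢z = cong (ψ w +_) (trans (ΔΦ-summand-other _≟_ w≢z)
    (cong (λ c → Φelt r (posAfterFetch π z w) (pos π* w) c - Φelt r (pos π w) (pos π* w) (b w)) (budgetAfterFetch-other b w≢z)))

  change-≤-bonus : (∀ w → 0ℚ ≤ b w) → ∀ w → change w ≤ bonus w
  change-≤-bonus b≥0 w = by-cases (w ≟ z)
    where
    open Potential r (pos π* w) (b w) using (A; Δ; Δ-refl; Δ-suc-cold; Δ-suc-hot)
    i = toℕ (π ⟨$⟩ʳ w)
    x = pos π w
    moved : pos π w ℕ.< P → Δ (suc x) x ≤ bonus w
    moved x<P = [ cold , hot ]′ (ℕ.<-≤-connex (p x) A)
      where
      cold : p x ℕ.< A → Δ (suc x) x ≤ bonus w
      cold px<A = ≤-trans (≤-reflexive (Δ-suc-cold i px<A)) (bonus-nonNeg w)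
      hot : A ℕ.≤ p x → Δ (suc x) x ≤ bonus w
      hot A≤px = ≤-trans (Δ-suc-hot (b≥0 w) i A≤px) (≤-reflexive (sym (if-T (ℕ.<⇒<ᵇ (hot-index A≤px x<P)))))
    by-position : w ≢ z → Dec (x ℕ.< P) → Δ (posAfterFetch π z w) x ≤ bonus w
    by-position w≢z (yes x<P) = subst (λ a → Δ a x ≤ bonus w) (sym (posAfterFetch-before w≢z x<P)) (moved x<P)
    by-position w≢z (no x≮P) = subst (λ a → Δ a x ≤ bonus w) (sym (posAfterFetch-after w≢z x≮P))
      (≤-trans (≤-reflexive (Δ-refl x)) (bonus-nonNeg w))
    by-cases : Dec (w ≡ z) → change w ≤ bonus w
    by-cases (yes refl) = ≤-trans change-self (bonus-nonNeg z)
    by-cases (no w≢z)   = subst (_≤ bonus w) (sym (change-other w≢z)) (by-position w≢z (x <? P))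

  Σbonus≤P : sumℚ bonus ≤ ℕ→ℚ P
  Σbonus≤P = *-cancelˡ-≤-pos (ℕ→ℚ 2) (begin
    ℕ→ℚ 2 * sumℚ bonus                          ≡⟨ cong (ℕ→ℚ 2 *_) (sumℚ-permute (below hot-bound) π*) ⟩
    ℕ→ℚ 2 * sumℚ (below hot-bound)              ≤⟨ *-monoˡ-≤-nonNeg (ℕ→ℚ 2) {{normalize-nonNeg 2 1}} (sumℚ-below-≤ {n} hot-bound 0≤3β) ⟩
    ℕ→ℚ 2 * (ℕ→ℚ hot-bound * (ℕ→ℚ 3 * β r))    ≡⟨ solve 4 (λ T H D B → T :* (H :* (D :* B)) := H :* (D :* (T :* B))) refl (ℕ→ℚ 2) (ℕ→ℚ hot-bound) (ℕ→ℚ 3) (β r) ⟩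
    ℕ→ℚ hot-bound * (ℕ→ℚ 3 * (ℕ→ℚ 2 * β r))    ≡⟨ cong (λ t → ℕ→ℚ hot-bound * (ℕ→ℚ 3 * t)) (2*β≡15r+10 r) ⟩
    ℕ→ℚ hot-bound * (ℕ→ℚ 3 * ℕ→ℚ s)           ≡⟨ trans (ℕ→ℚ-* hot-bound (3 ℕ.* s)) (cong (ℕ→ℚ hot-bound *_) (ℕ→ℚ-* 3 s)) ⟨
    ℕ→ℚ (hot-bound ℕ.* (3 ℕ.* s))              ≤⟨ ℕ→ℚ-mono-≤ (ℕ.≤-trans (ℕ.*-monoʳ-≤ hot-bound 3s≤K) (m/n*n≤m (2 ℕ.* P) K)) ⟩
    ℕ→ℚ (2 ℕ.* P)                              ≡⟨ ℕ→ℚ-* 2 P ⟩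
    ℕ→ℚ 2 * ℕ→ℚ P                              ∎)
    where
    open ≤-Reasoning
    open +-*-Solver
    s = 15 ℕ.* r ℕ.+ 10
    0≤3β : 0ℚ ≤ ℕ→ℚ 3 * β r
    0≤3β = *-nonNeg (ℕ→ℚ-nonNeg 3) (β-nonNeg r)
    3s≤K : 3 ℕ.* s ℕ.≤ K
    3s≤K = subst (ℕ._≤ K) (sym (trans (ℕ.*-distribˡ-+ 3 (15 ℕ.* r) 10) (cong (ℕ._+ 30) (sym (ℕ.*-assoc 3 15 r)))))
      (n≤2^⌈log₂n⌉ (45 ℕ.* r ℕ.+ 30))

open import Data.Nat using (_≥_)
open import Data.Nat.Properties using (m∸n≤m)
open import Data.Fin using (_≟_)
open import Data.Rational using (_≤_; _+_; _*_; 0ℚ)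
open import Data.Rational.Properties using (+-assoc; +-mono-≤; +-monoʳ-≤; module ≤-Reasoning)
open import Relation.Binary.PropositionalEquality using (cong)
open RationalFacts using (ℕ→ℚ-mono-≤; x+x≡2*x)
open Sums using (sumℚ-+; sumℚ-mono-≤)

lemma7 : (r : ℕ) → r ≥ 1 → (n : ℕ) → (π π* : Permutation′ n) → (b : Fin n → ℚ) →
    (∀ w → 0ℚ ≤ b w) → (z : Fin n) →
    ΔDLM π z + ΔΨ r π π* z + ΔΦothers r π π* b z ≤ ℕ→ℚ 2 * ℕ→ℚ (pos π z)
lemma7 r _ n π π* b b≥0 z = begin
  ΔDLM π z + ΔΨ r π π* z + ΔΦothers r π π* b z         ≡⟨ +-assoc (ΔDLM π z) _ _ ⟩
  ΔDLM π z + (sumℚ ψ + ΔΦothers r π π* b z)            ≡⟨ cong (λ t → ΔDLM π z + (sumℚ ψ + t)) ΔΦothers≡sum ⟩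
  ΔDLM π z + (sumℚ ψ + sumℚ (λ w → ΔΦ-summand w _≟_))  ≡⟨ cong (ΔDLM π z +_) (sumℚ-+ ψ _) ⟩
  ΔDLM π z + sumℚ change                               ≤⟨ +-mono-≤ (ℕ→ℚ-mono-≤ (m∸n≤m P 1)) (sumℚ-mono-≤ (change-≤-bonus b≥0)) ⟩
  ℕ→ℚ P + sumℚ bonus                                   ≤⟨ +-monoʳ-≤ (ℕ→ℚ P) Σbonus≤P ⟩
  ℕ→ℚ P + ℕ→ℚ P                                        ≡⟨ x+x≡2*x (ℕ→ℚ P) ⟩
  ℕ→ℚ 2 * ℕ→ℚ P                                        ∎
  where
  open FetchStep r π π* b z
  open ≤-Reasoning
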